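{- Let $G$ be an $r$-graph on $[n]$ with average degree $d>0$, let $\tau,\zeta>0$, and run the container algorithm (described in the context) with the strong threshold functions, in either prune mode (with any input $I\subset[n]$) or build mode (with any input $T\subset[n]$). Then, with $d_s(\cdot)$ and $\Gamma_s$ denoting their final values, for $s=2,\dots,r$ and every $\sigma\subset[n]$ with $2\le|\sigma|\le s$, $$d_s(\sigma)\le 2^{\binom r2}\tau^{r-s}\sum_{\ell=0}^{r-s}2^{ -\binom{s+\ell}{2}+\ell}\tau^{ -\ell}d^{(|\sigma|+\ell)}(\sigma),$$ and for every $\sigma$ with $2\le|\sigma|\le s-1$ and $\sigma\in\Gamma_{s-1}$, $$d_{s-1}(\sigma)\ge2^{s-1}\tau\, d_s(\sigma).$$
   Context: An $r$-graph ($r\ge2$) is an $r$-uniform hypergraph; $d(\sigma)$ is the number of edges containing $\sigma$, $d(v)=d(\{v\})$, $d$ the average degree, and $d^{(j)}(\sigma)=\max\{d(\sigma'):\sigma\subset\sigma'\subset[n],|\sigma'|=j\}$. Strong thresholds: for $1\le s\le r-1$, $\theta_s(\{u\})=\tau^{r-s}d(u)$, and for $\sigma$ with $2\le|\sigma|\le s$, $\theta_s(\sigma)=2^{\binom r2}\tau^{r-s}\sum_{\ell=0}^{r-s}2^{ -\binom{s+\ell}2}\tau^{ -\ell}d^{(|\sigma|+\ell)}(\sigma)$. Container algorithm (parameters $\tau,\zeta$, threshold functions $\theta_s$ fixed in advance): let $B=\{v:d(v)<\zeta d\}$. Let $P_r=E(G)$ (a multiset of $r$-sets), and initially $P_1,\dots,P_{r-1}$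 be empty multisets and $\Gamma_1,\dots,\Gamma_{r-1}$ empty sets. For $1\le s\le r$, $d_s(\sigma)$ denotes the number of members of $P_s$ (with multiplicity) containing $\sigma$. In prune mode the input is $I$ and initially $T=\emptyset$ (output $T$); in build mode the input is $T$ and initially $C=[n]$ (output $C$). For $v=1,2,\dots,n$ in turn: for each $s=1,\dots,r-1$ let $F_{v,s}$ be the multiset of $s$-sets $f\subset\{v+1,\dots,n\}$ with $\{v\}\cup f\in P_{s+1}$ (multiplicity inherited from $P_{s+1}$) such that no $\sigma\in\Gamma_s$ satisfies $\sigma\subset f$. If $v\notin B$ and either $|F_{v,s}|\ge\zeta\tau^{r-s-1}d(v)$ for some $s$ or $\{v\}\in\Gamma_1$, then: in prune mode add $v$ to $T$ if $v\in I$; in build mode remove $v$ from $C$ if $v\notin T$; and if $v\in T$, then for $s=1,\dots,r-1$ in turn add $F_{v,s}$ to $P_s$ and add to $\Gamma_s$ every $\sigma\subset\{v+1,\dots,n\}$ with $1\le|\sigma|\le s$ and $d_s(\sigma)\ge\theta_s(\sigma)$. Otherwise do nothing for $v$.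
   Formalization: The parameters τ and ζ range over the positive rationals. -}

module Defs where

open import Data.Bool using (Bool; true; false; _∧_; _∨_; not; if_then_else_)
open import Data.Nat as ℕ using (ℕ; zero; suc; _∸_; _<ᵇ_; _≡ᵇ_) renaming (_≤ᵇ_ to _≤ℕᵇ_)
open import Data.Nat.Properties using (m^n≢0)
open import Data.Nat.Combinatorics using (_C_)
open import Data.Integer using (+_)
open import Data.Rational using (ℚ; 0ℚ; 1ℚ; _+_; _*_; _/_; _≤_; _<_; _≤ᵇ_)
open import Data.Fin using (Fin; toℕ)
open import Data.Fin.Subset using (Subset; ⁅_⁆; ∣_∣; _∪_; _∈_)
open import Data.Vec using (Vec; []; _∷_; tabulate; lookup; zipWith; foldr)
open import Data.List as L using (List; []; _∷_; _++_; map; filterᵇ; length; allFin; upTo; foldl)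
open import Data.Bool.ListAction using (any)
open import Data.List.Relation.Unary.All using (All)
open import Data.List.Relation.Unary.Unique.Propositional using (Unique)
open import Relation.Binary.PropositionalEquality using (_≡_)

-- Basic boolean operations on subsets of [n] (represented as Subset n,
-- vertex i : Fin n stands for the vertex toℕ i + 1 of [n]).

_⊆ᵇ_ : ∀ {n} → Subset n → Subset n → Bool
[] ⊆ᵇ [] = true
(x ∷ xs) ⊆ᵇ (y ∷ ys) = ((not x) ∨ y) ∧ (xs ⊆ᵇ ys)

_≟ᵇ_ : ∀ {n} → Subset n → Subset n → Bool
σ ≟ᵇ τ = (σ ⊆ᵇ τ) ∧ (τ ⊆ᵇ σ)

_∖_ : ∀ {n} → Subset n → Subset n → Subset n
σ ∖ τ = zipWith (λ a b → a ∧ not b) σ τ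

allSubsets : (n : ℕ) → List (Subset n)
allSubsets zero = [] ∷ []
allSubsets (suc n) = map (true ∷_) (allSubsets n) ++ map (false ∷_) (allSubsets n)

above : ∀ {n} → Fin n → Subset n
above v = tabulate (λ u → toℕ v <ᵇ toℕ u)

count : ∀ {n} → List (Subset n) → Subset n → ℕ
count P σ = length (filterᵇ (λ p → σ ⊆ᵇ p) P)

memᵇ : ∀ {n} → Subset n → List (Subset n) → Bool
memᵇ σ Γ = any (λ γ → σ ≟ᵇ γ) Γ

ℕ→ℚ : ℕ → ℚ
ℕ→ℚ k = (+ k) / 1

_^ℚ_ : ℚ → ℕ → ℚ
x ^ℚ zero = 1ℚ
x ^ℚ suc k = x * (x ^ℚ k)

two^ : ℕ → ℚ
two^ k = ℕ→ℚ (2 ℕ.^ k)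

two^- : ℕ → ℚ
two^- k = _/_ (+ 1) (2 ℕ.^ k) {{m^n≢0 2 k}}

sumTo : ℕ → (ℕ → ℚ) → ℚ
sumTo m f = L.foldr (λ ℓ acc → f ℓ + acc) 0ℚ (upTo (suc m))

record RGraph (r n : ℕ) : Set where
  field
    edges   : List (Subset n)
    simple  : Unique edges
    uniform : All (λ e → ∣ e ∣ ≡ r) edges
open RGraph public

module _ {r n : ℕ} (G : RGraph r n) where

  deg : Subset n → ℕ
  deg σ = count (edges G) σ

  -- average degree d = r |E(G)| / n  (0 when n = 0)
  avgDeg : ℚ
  avgDeg = avg n (r ℕ.* length (edges G))
    where
      avg : ℕ → ℕ → ℚ
      avg zero _ = 0ℚ
      avg (suc m) k = (+ k) / suc m

  -- d^{(j)}(σ) = max { d(σ') : σ ⊆ σ' ⊆ [n], |σ'| = j }  (0 if no such σ')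
  degMax : ℕ → Subset n → ℕ
  degMax j σ = L.foldr ℕ._⊔_ 0
    (map deg (filterᵇ (λ σ' → (σ ⊆ᵇ σ') ∧ (∣ σ' ∣ ≡ᵇ j)) (allSubsets n)))

  -- Strong thresholds θ_s(σ) (used for 1 ≤ |σ| ≤ s ≤ r - 1).
  -- τ^{r-s} τ^{-ℓ} is written τ^{r-s-ℓ} (exact, since ℓ ≤ r-s).
  θ : ℚ → ℕ → Subset n → ℚ
  θ τ s σ with ∣ σ ∣
  ... | 1 = (τ ^ℚ (r ∸ s)) * ℕ→ℚ (deg σ)
  ... | k = two^ (r C 2) * sumTo (r ∸ s) (λ ℓ →
              two^- ((s ℕ.+ ℓ) C 2) * ((τ ^ℚ ((r ∸ s) ∸ ℓ)) * ℕ→ℚ (degMax (k ℕ.+ ℓ) σ)))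

  data Mode : Set where
    prune : (I : Subset n) → Mode
    build : (T : Subset n) → Mode

  record State : Set where
    field
      T : Subset n
      Cset : Subset n
      P : ℕ → List (Subset n)
      Γ : ℕ → List (Subset n)
  open State public

  initState : Mode → State
  initState m = record
    { T = initT m
    ; Cset = Data.Fin.Subset.⊤
    ; P = λ s → if s ≡ᵇ r then edges G else []
    ; Γ = λ _ → [] }
    where
      initT : Mode → Subset n
      initT (prune I) = Data.Fin.Subset.⊥
      initT (build T) = T

  dS : State → ℕ → Subset n → ℕ
  dS st s σ = count (P st s) σ

  module Algo (τ ζ : ℚ) where

    inB : Fin n → Bool
    inB v = not ((ζ * avgDeg) ≤ᵇ ℕ→ℚ (deg ⁅ v ⁆))

    F : State → Fin n → ℕ → List (Subset n)
    F st v s =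
      filterᵇ (λ f → not (any (λ γ → γ ⊆ᵇ f) (Γ st s)))
        (map (λ p → p ∖ ⁅ v ⁆)
          (filterᵇ (λ p → lookup p v ∧ ((p ∖ ⁅ v ⁆) ⊆ᵇ above v)) (P st (suc s))))

    sRange : List ℕ
    sRange = map suc (upTo (r ∸ 1))

    triggered : State → Fin n → Bool
    triggered st v =
      not (inB v) ∧
      (any (λ s → (ζ * ((τ ^ℚ (r ∸ s ∸ 1)) * ℕ→ℚ (deg ⁅ v ⁆))) ≤ᵇ ℕ→ℚ (length (F st v s))) sRange
       ∨ memᵇ ⁅ v ⁆ (Γ st 1))

    updateS : Fin n → (ℕ → List (Subset n)) → State → ℕ → State
    updateS v Fs st s = record st { P = P' ; Γ = Γ' }
      where
        Ps : List (Subset n)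
        Ps = P st s ++ Fs s
        P' : ℕ → List (Subset n)
        P' t = if t ≡ᵇ s then Ps else P st t
        new : List (Subset n)
        new = filterᵇ (λ σ → (σ ⊆ᵇ above v) ∧ (1 ≤ℕᵇ ∣ σ ∣) ∧ (∣ σ ∣ ≤ℕᵇ s)
                              ∧ (θ τ s σ ≤ᵇ ℕ→ℚ (count Ps σ)))
                      (allSubsets n)
        Γ' : ℕ → List (Subset n)
        Γ' t = if t ≡ᵇ s then Γ st s ++ new else Γ st t

    modeAct : Mode → Fin n → State → State
    modeAct (prune I) v st = record st { T = if lookup I v then T st ∪ ⁅ v ⁆ else T st }
    modeAct (build _) v st = record st { Cset = if lookup (T st) v then Cset st else Cset st ∖ ⁅ v ⁆ }

    step : Mode → State → Fin n → State
    step m st v = if triggered st v then afterMode else st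
      where
        Fs : ℕ → List (Subset n)
        Fs = F st v
        st₁ : State
        st₁ = modeAct m v st
        afterMode : State
        afterMode = if lookup (T st₁) v then foldl (updateS v Fs) st₁ sRange else st₁

    run : Mode → State
    run m = foldl (step m) (initState m) (allFin n)

module Submission where

-- Write bound_s(σ) for that right-hand side and θ_s(σ) for the strong
-- threshold.  Two inequalities between these sums (ProfileSums) carry the
-- proof: absorption, θ_s(σ) + bound_{s+1}(σ ∪ {v}) ≤ bound_s(σ), and
-- domination, 2^s τ bound_{s+1}(σ) ≤ θ_s(σ).  The algorithm maintains an
-- invariant vertex by vertex (Container): every d_s respects bound_s; a σ
-- above the processed vertices and not covered by Γ_s is below its
-- threshold; members of Γ_s have reached theirs.  When F_{v,s} joins P_s,
-- every σ it touches lies above v and is uncovered, so its old count is at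
-- most θ_s(σ) while the new members are counted by d_{s+1}(σ ∪ {v}), and
-- absorption closes the step.  The lemma is the final invariant, plus
-- domination for the second part.

open import Defs hiding (T)
open import Data.Nat as ℕ using (ℕ; zero; suc; _∸_; _⊔_; _≡ᵇ_; z≤n; s≤s)
  renaming (_≤_ to _≤ℕ_; _+_ to _+ℕ_; _<_ to _<ℕ_; _≤ᵇ_ to _≤ℕᵇ_)
import Data.Nat.Properties as ℕP
open import Data.Nat.Combinatorics using (_C_; nCk+nC[k+1]≡[n+1]C[k+1]; nC1≡n)
open import Data.Nat.Coprimality using (1-coprimeTo) renaming (sym to coprime-sym)
open import Data.Integer as ℤ using () renaming (+_ to ⁺_)
import Data.Integer.Properties as ℤP
open import Data.Rational as ℚ using (ℚ; mkℚ; 0ℚ; 1ℚ; _+_; _*_; _/_; _≤_; _<_; _≤ᵇ_; *≤*)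
import Data.Rational.Properties as ℚP
open import Data.Rational.Solver using (module +-*-Solver)
open import Data.Bool using (Bool; true; false; T; T?; _∧_; not; if_then_else_)
open import Data.Bool.Properties using (T-∧; T-≡; T-not-≡)
open import Data.Bool.ListAction using (any)
open import Data.Fin as Fin using (Fin; toℕ)
open import Data.Fin.Subset using (Subset; ∣_∣; ⁅_⁆; _∪_; _⊆_; _∉_) renaming (_∈_ to _∈ˢ_)
open import Data.Fin.Subset.Properties using (drop-∷-⊆; ∪-identityʳ; ⊆-refl; ⊆-trans; p⊆p∪q; x∈p∪q⁻; x∈⁅y⁆⇒x≡y)
open import Data.Vec using (_∷_; []; here; there; lookup)
open import Data.Vec.Properties using (lookup⇒[]=; []=⇒lookup; lookup∘tabulate)
open import Data.List as List using (List; _∷_; []; _++_; map; filterᵇ; applyUpTo)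
open import Data.List.Properties using (filter-++; length-++; map-upTo)
open import Data.List.Relation.Unary.Any using (here; there)
open import Data.List.Relation.Unary.Any.Properties using (any⁺; any⁻)
open import Data.List.Membership.Propositional using (_∈_; lose; find)
open import Data.List.Membership.Propositional.Properties using (∈-++⁺ˡ; ∈-++⁺ʳ; ∈-++⁻; ∈-map⁺; ∈-map⁻; ∈-filter⁻; ∈-filter⁺)
open import Data.Product using (Σ; _×_; _,_; proj₁; proj₂)
open import Data.Sum using (_⊎_; inj₁; inj₂; [_,_]′)
open import Data.Unit using (tt)
open import Data.Empty using (⊥-elim)
open import Function using (_∘_; Equivalence)
open import Relation.Binary.PropositionalEquality
  using (_≡_; _≢_; refl; sym; trans; cong; cong₂; cong-app; subst; subst₂; module ≡-Reasoning)
open import Relation.Nullary using (¬_)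
open import Relation.Nullary.Decidable using (toSum)

open +-*-Solver using (solve; _:+_; _:*_; _:=_; con)

ℕ→ℚ≡k/1 : ∀ k → ℕ→ℚ k ≡ mkℚ (⁺ k) 0 (coprime-sym (1-coprimeTo k))
ℕ→ℚ≡k/1 k = ℚP.normalize-coprime (coprime-sym (1-coprimeTo k))

ℕ→ℚ-+ : ∀ a b → ℕ→ℚ (a +ℕ b) ≡ ℕ→ℚ a + ℕ→ℚ b
ℕ→ℚ-+ a b rewrite ℕ→ℚ≡k/1 a | ℕ→ℚ≡k/1 b =
  sym (ℚP./-cong {p₁ = ⁺ a ℤ.* ⁺ 1 ℤ.+ ⁺ b ℤ.* ⁺ 1} {q₁ = 1} {p₂ = ⁺ (a +ℕ b)} {q₂ = 1}
         (cong₂ ℤ._+_ (ℤP.*-identityʳ (⁺ a)) (ℤP.*-identityʳ (⁺ b))) refl)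

ℕ→ℚ-* : ∀ a b → ℕ→ℚ (a ℕ.* b) ≡ ℕ→ℚ a * ℕ→ℚ b
ℕ→ℚ-* a b rewrite ℕ→ℚ≡k/1 a | ℕ→ℚ≡k/1 b =
  sym (ℚP./-cong {p₁ = ⁺ a ℤ.* ⁺ b} {q₁ = 1} {p₂ = ⁺ (a ℕ.* b)} {q₂ = 1} (sym (ℤP.pos-* a b)) refl)

ℕ→ℚ-mono : ∀ {a b} → a ≤ℕ b → ℕ→ℚ a ≤ ℕ→ℚ b
ℕ→ℚ-mono {a} {b} a≤b rewrite ℕ→ℚ≡k/1 a | ℕ→ℚ≡k/1 b =
  *≤* (subst₂ ℤ._≤_ (sym (ℤP.*-identityʳ (⁺ a))) (sym (ℤP.*-identityʳ (⁺ b))) (ℤ.+≤+ a≤b))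

ℕ→ℚ-0 : ℕ→ℚ 0 ≡ 0ℚ
ℕ→ℚ-0 = ℕ→ℚ≡k/1 0

ℕ→ℚ-nonneg : ∀ a → 0ℚ ≤ ℕ→ℚ a
ℕ→ℚ-nonneg a = subst (_≤ ℕ→ℚ a) ℕ→ℚ-0 (ℕ→ℚ-mono {0} {a} z≤n)

-- Order facts for nonnegative factors, with the sign hypothesis as an
-- ordinary argument rather than an instance.
*-nonneg : ∀ {x y} → 0ℚ ≤ x → 0ℚ ≤ y → 0ℚ ≤ x * y
*-nonneg {x} {y} 0≤x 0≤y =
  ℚP.nonNegative⁻¹ _ {{ℚP.nonNeg*nonNeg⇒nonNeg x {{ℚ.nonNegative 0≤x}} y {{ℚ.nonNegative 0≤y}}}}

*-monoˡ-≤-nonneg : ∀ {c x y} → 0ℚ ≤ c → x ≤ y → c * x ≤ c * y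
*-monoˡ-≤-nonneg {c} 0≤c = ℚP.*-monoˡ-≤-nonNeg c {{ℚ.nonNegative 0≤c}}

*-monoʳ-≤-nonneg : ∀ {c x y} → 0ℚ ≤ c → x ≤ y → x * c ≤ y * c
*-monoʳ-≤-nonneg {c} 0≤c = ℚP.*-monoʳ-≤-nonNeg c {{ℚ.nonNegative 0≤c}}

^ℚ-nonneg : ∀ {τ} → 0ℚ ≤ τ → ∀ k → 0ℚ ≤ τ ^ℚ k
^ℚ-nonneg 0≤τ zero = ℚP.nonNegative⁻¹ 1ℚ
^ℚ-nonneg 0≤τ (suc k) = *-nonneg 0≤τ (^ℚ-nonneg 0≤τ k)

two^-nonneg : ∀ k → 0ℚ ≤ two^ k
two^-nonneg k = ℕ→ℚ-nonneg (2 ℕ.^ k)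

1≤two^ : ∀ k → 1ℚ ≤ two^ k
1≤two^ k = ℕ→ℚ-mono {1} {2 ℕ.^ k} (ℕP.m^n>0 2 k)

two^-+ : ∀ a c → two^ (a +ℕ c) ≡ two^ a * two^ c
two^-+ a c = trans (cong ℕ→ℚ (ℕP.^-distribˡ-+-* 2 a c)) (ℕ→ℚ-* (2 ℕ.^ a) (2 ℕ.^ c))

two^-suc : ∀ k → two^ (suc k) ≡ two^ k + two^ k
two^-suc k = begin
  ℕ→ℚ (2 ℕ.^ k +ℕ (2 ℕ.^ k +ℕ 0))  ≡⟨ ℕ→ℚ-+ (2 ℕ.^ k) _ ⟩
  two^ k + ℕ→ℚ (2 ℕ.^ k +ℕ 0)      ≡⟨ cong (λ x → two^ k + ℕ→ℚ x) (ℕP.+-identityʳ (2 ℕ.^ k)) ⟩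
  two^ k + two^ k                   ∎
  where open ≡-Reasoning

two^⁻-nonneg : ∀ k → 0ℚ ≤ two^- k
two^⁻-nonneg k = ℚP.nonNegative⁻¹ _ {{ℚP.normalize-nonNeg 1 (2 ℕ.^ k) {{ℕP.m^n≢0 2 k}}}}

two^⁻-inverse : ∀ k → two^- k * two^ k ≡ 1ℚ
two^⁻-inverse k = inverse (2 ℕ.^ k) {{ℕP.m^n≢0 2 k}}
  where
  inverse : ∀ a .{{_ : ℕ.NonZero a}} → ((⁺ 1) / a) * ℕ→ℚ a ≡ 1ℚ
  inverse (suc a) rewrite ℕ→ℚ≡k/1 (suc a) =
    trans (cong (_* a/1) (ℚP.normalize-coprime {1} {a} (1-coprimeTo (suc a)))) (ℚP.*-inverseˡ a/1)
    where a/1 = mkℚ (⁺ suc a) 0 (coprime-sym (1-coprimeTo (suc a)))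

two^⁻-shift : ∀ c a → two^- (c +ℕ a) * two^ a ≡ two^- c
two^⁻-shift c a = begin
  X * two^ a                               ≡⟨ sym (ℚP.*-identityʳ _) ⟩
  (X * two^ a) * 1ℚ                        ≡⟨ cong ((X * two^ a) *_) (sym inv-c) ⟩
  (X * two^ a) * (two^ c * two^- c)        ≡⟨ solve 4 (λ x p q y → (x :* p) :* (q :* y) := (x :* (q :* p)) :* y)
                                                 refl X (two^ a) (two^ c) (two^- c) ⟩
  (X * (two^ c * two^ a)) * two^- c        ≡⟨ cong (λ z → (X * z) * two^- c) (sym (two^-+ c a)) ⟩
  (X * two^ (c +ℕ a)) * two^- c            ≡⟨ cong (_* two^- c) (two^⁻-inverse (c +ℕ a)) ⟩
  1ℚ * two^- c                             ≡⟨ ℚP.*-identityˡ _ ⟩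
  two^- c                                  ∎
  where
  open ≡-Reasoning
  X = two^- (c +ℕ a)
  inv-c : two^ c * two^- c ≡ 1ℚ
  inv-c = trans (ℚP.*-comm (two^ c) (two^- c)) (two^⁻-inverse c)

suc-C2 : ∀ a → suc a C 2 ≡ a C 2 +ℕ a
suc-C2 a = trans (sym (nCk+nC[k+1]≡[n+1]C[k+1] a 1))
                 (trans (cong (_+ℕ a C 2) (nC1≡n a)) (ℕP.+-comm a (a C 2)))

Σ< : ℕ → (ℕ → ℚ) → ℚ
Σ< zero f = 0ℚ
Σ< (suc k) f = f 0 + Σ< k (f ∘ suc)

sumTo≡Σ< : ∀ m f → sumTo m f ≡ Σ< (suc m) f
sumTo≡Σ< m f = fold (suc m) (λ ℓ → ℓ) f
  where
  fold : ∀ k (g : ℕ → ℕ) (f : ℕ → ℚ) →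
         List.foldr (λ ℓ acc → f ℓ + acc) 0ℚ (applyUpTo g k) ≡ Σ< k (f ∘ g)
  fold zero g f = refl
  fold (suc k) g f = cong (f (g 0) +_) (fold k (g ∘ suc) f)

Σ<-mono : ∀ k {f g} → (∀ ℓ → ℓ <ℕ k → f ℓ ≤ g ℓ) → Σ< k f ≤ Σ< k g
Σ<-mono zero f≤g = ℚP.≤-refl
Σ<-mono (suc k) f≤g = ℚP.+-mono-≤ (f≤g 0 (s≤s z≤n)) (Σ<-mono k (λ ℓ ℓ<k → f≤g (suc ℓ) (s≤s ℓ<k)))

Σ<-cong : ∀ k {f g} → (∀ ℓ → ℓ <ℕ k → f ℓ ≡ g ℓ) → Σ< k f ≡ Σ< k g
Σ<-cong zero f≡g = refl
Σ<-cong (suc k) f≡g = cong₂ _+_ (f≡g 0 (s≤s z≤n)) (Σ<-cong k (λ ℓ ℓ<k → f≡g (suc ℓ) (s≤s ℓ<k)))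

Σ<-nonneg : ∀ k {f} → (∀ ℓ → 0ℚ ≤ f ℓ) → 0ℚ ≤ Σ< k f
Σ<-nonneg zero 0≤f = ℚP.≤-refl
Σ<-nonneg (suc k) 0≤f = ℚP.+-mono-≤ (0≤f 0) (Σ<-nonneg k (0≤f ∘ suc))

Σ<-+ : ∀ k f g → Σ< k f + Σ< k g ≡ Σ< k (λ ℓ → f ℓ + g ℓ)
Σ<-+ zero f g = ℚP.+-identityʳ 0ℚ
Σ<-+ (suc k) f g =
  trans (solve 4 (λ a b c d → (a :+ b) :+ (c :+ d) := (a :+ c) :+ (b :+ d)) refl (f 0) (Σ< k _) (g 0) (Σ< k _))
        (cong ((f 0 + g 0) +_) (Σ<-+ k (f ∘ suc) (g ∘ suc)))

Σ<-*ˡ : ∀ k c f → c * Σ< k f ≡ Σ< k (λ ℓ → c * f ℓ)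
Σ<-*ˡ zero c f = ℚP.*-zeroʳ c
Σ<-*ˡ (suc k) c f = trans (ℚP.*-distribˡ-+ c (f 0) _) (cong (c * f 0 +_) (Σ<-*ˡ k c (f ∘ suc)))

Σ<-≤-Σ<-suc : ∀ k {f} → (∀ ℓ → 0ℚ ≤ f ℓ) → Σ< k f ≤ Σ< (suc k) f
Σ<-≤-Σ<-suc zero {f} 0≤f = ℚP.≤-trans (0≤f 0) (ℚP.≤-reflexive (sym (ℚP.+-identityʳ (f 0))))
Σ<-≤-Σ<-suc (suc k) {f} 0≤f = ℚP.+-monoʳ-≤ (f 0) (Σ<-≤-Σ<-suc k (0≤f ∘ suc))

-- For a sequence D (in the application D ℓ = d^{(|σ|+ℓ)}(σ)), a level s
-- and a depth m (= r - s):
--   thrSum m s D = Σ_{ℓ ≤ m} 2^{-C(s+ℓ,2)}     τ^{m-ℓ} D ℓ   (the strong threshold sum)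
--   bndSum m s D = Σ_{ℓ ≤ m} 2^{-C(s+ℓ,2)} 2^ℓ τ^{m-ℓ} D ℓ   (the claimed degree bound sum)
-- The lemma rests on two inequalities between them: the threshold at level s
-- plus a bound at level s+1 is absorbed by the bound at level s, and 2^s τ
-- times the bound at level s+1 is dominated by the threshold at level s.
module ProfileSums (τ : ℚ) (0≤τ : 0ℚ ≤ τ) where

  thrTerm bndTerm : ℕ → ℕ → (ℕ → ℚ) → ℕ → ℚ
  thrTerm m s D ℓ = two^- ((s +ℕ ℓ) C 2) * ((τ ^ℚ (m ∸ ℓ)) * D ℓ)
  bndTerm m s D ℓ = (two^- ((s +ℕ ℓ) C 2) * two^ ℓ) * ((τ ^ℚ (m ∸ ℓ)) * D ℓ)

  thrSum bndSum : ℕ → ℕ → (ℕ → ℚ) → ℚ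
  thrSum m s D = sumTo m (thrTerm m s D)
  bndSum m s D = sumTo m (bndTerm m s D)

  thrTerm-nonneg : ∀ m s D → (∀ ℓ → 0ℚ ≤ D ℓ) → ∀ ℓ → 0ℚ ≤ thrTerm m s D ℓ
  thrTerm-nonneg m s D 0≤D ℓ =
    *-nonneg (two^⁻-nonneg ((s +ℕ ℓ) C 2)) (*-nonneg (^ℚ-nonneg 0≤τ (m ∸ ℓ)) (0≤D ℓ))

  thrSum-nonneg : ∀ m s D → (∀ ℓ → 0ℚ ≤ D ℓ) → 0ℚ ≤ thrSum m s D
  thrSum-nonneg m s D 0≤D =
    subst (0ℚ ≤_) (sym (sumTo≡Σ< m (thrTerm m s D))) (Σ<-nonneg (suc m) (thrTerm-nonneg m s D 0≤D))

  bndSum-nonneg : ∀ m s D → (∀ ℓ → 0ℚ ≤ D ℓ) → 0ℚ ≤ bndSum m s D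
  bndSum-nonneg m s D 0≤D = subst (0ℚ ≤_) (sym (sumTo≡Σ< m (bndTerm m s D))) (Σ<-nonneg (suc m) (λ ℓ →
    *-nonneg (*-nonneg (two^⁻-nonneg ((s +ℕ ℓ) C 2)) (two^-nonneg ℓ)) (*-nonneg (^ℚ-nonneg 0≤τ (m ∸ ℓ)) (0≤D ℓ))))

  bndSum-depth0 : ∀ s D → two^ (s C 2) * bndSum 0 s D ≡ D 0
  bndSum-depth0 s D = begin
    two^ (s C 2) * ((two^- ((s +ℕ 0) C 2) * ℕ→ℚ 1) * (1ℚ * D 0) + 0ℚ)
      ≡⟨ cong₂ (λ k one → two^ (s C 2) * ((two^- (k C 2) * one) * (1ℚ * D 0) + 0ℚ))
               (ℕP.+-identityʳ s) (ℕ→ℚ≡k/1 1) ⟩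
    two^ (s C 2) * ((two^- (s C 2) * 1ℚ) * (1ℚ * D 0) + 0ℚ)
      ≡⟨ solve 3 (λ p q d → p :* ((q :* con 1ℚ) :* (con 1ℚ :* d) :+ con 0ℚ) := (q :* p) :* d)
               refl (two^ (s C 2)) (two^- (s C 2)) (D 0) ⟩
    (two^- (s C 2) * two^ (s C 2)) * D 0
      ≡⟨ cong (_* D 0) (two^⁻-inverse (s C 2)) ⟩
    1ℚ * D 0
      ≡⟨ ℚP.*-identityˡ (D 0) ⟩
    D 0 ∎
    where open ≡-Reasoning

  absorb-term : ∀ ℓ {x y y'} → 0ℚ ≤ x → 0ℚ ≤ y → y' ≤ y →
                x * y + (x * two^ ℓ) * y' ≤ (x * two^ (suc ℓ)) * y
  absorb-term ℓ {x} {y} {y'} 0≤x 0≤y y'≤y = begin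
    x * y + (x * two^ ℓ) * y'
      ≤⟨ ℚP.+-mono-≤ x≤x2^ℓ (*-monoˡ-≤-nonneg (*-nonneg 0≤x (two^-nonneg ℓ)) y'≤y) ⟩
    (x * two^ ℓ) * y + (x * two^ ℓ) * y
      ≡⟨ solve 3 (λ x q y → (x :* q) :* y :+ (x :* q) :* y := (x :* (q :+ q)) :* y) refl x (two^ ℓ) y ⟩
    (x * (two^ ℓ + two^ ℓ)) * y
      ≡⟨ cong (λ z → (x * z) * y) (sym (two^-suc ℓ)) ⟩
    (x * two^ (suc ℓ)) * y ∎
    where
    open ℚP.≤-Reasoning
    x≤x2^ℓ : x * y ≤ (x * two^ ℓ) * y
    x≤x2^ℓ = *-monoʳ-≤-nonneg 0≤y
      (subst (_≤ x * two^ ℓ) (ℚP.*-identityʳ x) (*-monoˡ-≤-nonneg 0≤x (1≤two^ ℓ)))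

  -- The ℓ = 0 terms agree; the later terms
  -- are paired by absorb-term.
  absorb : ∀ m s D D' → (∀ ℓ → 0ℚ ≤ D ℓ) → (∀ ℓ → D' ℓ ≤ D (suc ℓ)) →
           thrSum (suc m) s D + bndSum m (suc s) D' ≤ bndSum (suc m) s D
  absorb m s D D' 0≤D D'≤D = begin
    sumTo (suc m) t + sumTo m c
      ≡⟨ cong₂ _+_ (sumTo≡Σ< (suc m) t) (sumTo≡Σ< m c) ⟩
    (t 0 + Σ< (suc m) (t ∘ suc)) + Σ< (suc m) c
      ≡⟨ ℚP.+-assoc (t 0) _ _ ⟩
    t 0 + (Σ< (suc m) (t ∘ suc) + Σ< (suc m) c)
      ≡⟨ cong (t 0 +_) (Σ<-+ (suc m) (t ∘ suc) c) ⟩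
    t 0 + Σ< (suc m) (λ ℓ → t (suc ℓ) + c ℓ)
      ≤⟨ ℚP.+-mono-≤ (ℚP.≤-reflexive t0≡b0) (Σ<-mono (suc m) (λ ℓ _ → paired ℓ)) ⟩
    b 0 + Σ< (suc m) (b ∘ suc)
      ≡⟨ sym (sumTo≡Σ< (suc m) b) ⟩
    sumTo (suc m) b ∎
    where
    open ℚP.≤-Reasoning
    t b c : ℕ → ℚ
    t = thrTerm (suc m) s D
    b = bndTerm (suc m) s D
    c = bndTerm m (suc s) D'
    t0≡b0 : t 0 ≡ b 0
    t0≡b0 = cong (_* ((τ ^ℚ (suc m)) * D 0)) (sym (ℚP.*-identityʳ (two^- ((s +ℕ 0) C 2))))
    paired : ∀ ℓ → t (suc ℓ) + c ℓ ≤ b (suc ℓ)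
    paired ℓ = subst (λ k → t (suc ℓ) + (two^- (k C 2) * two^ ℓ) * ((τ ^ℚ (m ∸ ℓ)) * D' ℓ) ≤ b (suc ℓ))
      (ℕP.+-suc s ℓ)
      (absorb-term ℓ (two^⁻-nonneg ((s +ℕ suc ℓ) C 2)) (*-nonneg (^ℚ-nonneg 0≤τ (m ∸ ℓ)) (0≤D (suc ℓ)))
                     (*-monoˡ-≤-nonneg (^ℚ-nonneg 0≤τ (m ∸ ℓ)) (D'≤D ℓ)))

  -- Termwise form of domination: for ℓ ≤ m,
  --   2^s τ · 2^{-C(s+1+ℓ,2)} 2^ℓ τ^{m-ℓ} = 2^{-C(s+ℓ,2)} τ^{m+1-ℓ},
  -- because C(s+ℓ+1,2) = C(s+ℓ,2) + s + ℓ.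
  dominate-term : ∀ m s ℓ y → ℓ ≤ℕ m →
    (two^ s * τ) * ((two^- ((suc s +ℕ ℓ) C 2) * two^ ℓ) * ((τ ^ℚ (m ∸ ℓ)) * y))
      ≡ two^- ((s +ℕ ℓ) C 2) * ((τ ^ℚ (suc m ∸ ℓ)) * y)
  dominate-term m s ℓ y ℓ≤m = begin
    (two^ s * τ) * ((Z * two^ ℓ) * ((τ ^ℚ (m ∸ ℓ)) * y))
      ≡⟨ solve 6 (λ p t z q u y → (p :* t) :* ((z :* q) :* (u :* y)) := (z :* (p :* q)) :* ((t :* u) :* y))
               refl (two^ s) τ Z (two^ ℓ) (τ ^ℚ (m ∸ ℓ)) y ⟩
    (Z * (two^ s * two^ ℓ)) * ((τ * (τ ^ℚ (m ∸ ℓ))) * y)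
      ≡⟨ cong₂ (λ p u → p * (u * y)) powers-of-two powers-of-τ ⟩
    two^- ((s +ℕ ℓ) C 2) * ((τ ^ℚ (suc m ∸ ℓ)) * y) ∎
    where
    open ≡-Reasoning
    Z = two^- ((suc s +ℕ ℓ) C 2)
    powers-of-two : Z * (two^ s * two^ ℓ) ≡ two^- ((s +ℕ ℓ) C 2)
    powers-of-two = trans (cong₂ (λ k p → two^- k * p) (suc-C2 (s +ℕ ℓ)) (sym (two^-+ s ℓ)))
                          (two^⁻-shift ((s +ℕ ℓ) C 2) (s +ℕ ℓ))
    powers-of-τ : τ * (τ ^ℚ (m ∸ ℓ)) ≡ τ ^ℚ (suc m ∸ ℓ)
    powers-of-τ = cong (τ ^ℚ_) (sym (ℕP.+-∸-assoc 1 ℓ≤m))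

  -- Domination: 2^s τ times the bound at level s+1 (depth m) is at most
  -- the threshold sum at level s (depth m+1); the latter has one more
  -- (nonnegative) term.
  dominate : ∀ m s D → (∀ ℓ → 0ℚ ≤ D ℓ) → (two^ s * τ) * bndSum m (suc s) D ≤ thrSum (suc m) s D
  dominate m s D 0≤D = begin
    p * sumTo m b                ≡⟨ cong (p *_) (sumTo≡Σ< m b) ⟩
    p * Σ< (suc m) b             ≡⟨ Σ<-*ˡ (suc m) p b ⟩
    Σ< (suc m) (λ ℓ → p * b ℓ)   ≡⟨ Σ<-cong (suc m) (λ ℓ ℓ<m+1 → dominate-term m s ℓ (D ℓ) (ℕP.≤-pred ℓ<m+1)) ⟩
    Σ< (suc m) t                 ≤⟨ Σ<-≤-Σ<-suc (suc m) (thrTerm-nonneg (suc m) s D 0≤D) ⟩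
    Σ< (suc (suc m)) t           ≡⟨ sym (sumTo≡Σ< (suc m) t) ⟩
    sumTo (suc m) t ∎
    where
    open ℚP.≤-Reasoning
    p = two^ s * τ
    b t : ℕ → ℚ
    b = bndTerm m (suc s) D
    t = thrTerm (suc m) s D

⊆ᵇ⇒⊆ : ∀ {n} {σ σ' : Subset n} → T (σ ⊆ᵇ σ') → σ ⊆ σ'
⊆ᵇ⇒⊆ {σ = true ∷ σ} {true ∷ σ'} _ here = here
⊆ᵇ⇒⊆ {σ = x ∷ σ} {y ∷ σ'} h (there u∈σ) = there (⊆ᵇ⇒⊆ (proj₂ (Equivalence.to T-∧ h)) u∈σ)

⊆⇒⊆ᵇ : ∀ {n} {σ σ' : Subset n} → σ ⊆ σ' → T (σ ⊆ᵇ σ')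
⊆⇒⊆ᵇ {σ = []} {[]} _ = tt
⊆⇒⊆ᵇ {σ = false ∷ σ} {y ∷ σ'} σ⊆σ' = ⊆⇒⊆ᵇ (drop-∷-⊆ σ⊆σ')
⊆⇒⊆ᵇ {σ = true ∷ σ} {y ∷ σ'} σ⊆σ' with σ⊆σ' here
... | here = ⊆⇒⊆ᵇ (drop-∷-⊆ σ⊆σ')

lookup⇒∈ : ∀ {n} {σ : Subset n} {u} → T (lookup σ u) → u ∈ˢ σ
lookup⇒∈ {σ = σ} {u} h = lookup⇒[]= u σ (Equivalence.to T-≡ h)

∖-⊆ : ∀ {n} (σ σ' : Subset n) → σ ∖ σ' ⊆ σ
∖-⊆ (true ∷ σ) (false ∷ σ') here = here
∖-⊆ (x ∷ σ) (y ∷ σ') (there u∈σ∖σ') = there (∖-⊆ σ σ' u∈σ∖σ')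

∈-above⁻ : ∀ {n} (v : Fin n) {u} → u ∈ˢ above v → toℕ v <ℕ toℕ u
∈-above⁻ v {u} u∈ = ℕP.<ᵇ⇒< (toℕ v) (toℕ u)
  (Equivalence.from T-≡ (trans (sym (lookup∘tabulate _ u)) ([]=⇒lookup u∈)))

∈-above⁺ : ∀ {n} (v : Fin n) {u} → toℕ v <ℕ toℕ u → u ∈ˢ above v
∈-above⁺ v {u} v<u = lookup⇒[]= u (above v)
  (trans (lookup∘tabulate _ u) (Equivalence.to T-≡ (ℕP.<⇒<ᵇ v<u)))

∉-above : ∀ {n} (v : Fin n) {σ} → σ ⊆ above v → v ∉ σ
∉-above v σ⊆above v∈σ = ℕP.<-irrefl refl (∈-above⁻ v (σ⊆above v∈σ))

∣∪⁅⁆∣ : ∀ {n} (σ : Subset n) {v} → v ∉ σ → ∣ σ ∪ ⁅ v ⁆ ∣ ≡ suc ∣ σ ∣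
∣∪⁅⁆∣ (false ∷ σ) {Fin.zero} _ = cong (suc ∘ ∣_∣) (∪-identityʳ σ)
∣∪⁅⁆∣ (true ∷ σ) {Fin.zero} v∉σ = ⊥-elim (v∉σ here)
∣∪⁅⁆∣ (true ∷ σ) {Fin.suc v} v∉σ = cong suc (∣∪⁅⁆∣ σ (v∉σ ∘ there))
∣∪⁅⁆∣ (false ∷ σ) {Fin.suc v} v∉σ = ∣∪⁅⁆∣ σ (v∉σ ∘ there)

∈-allSubsets : ∀ {n} (σ : Subset n) → σ ∈ allSubsets n
∈-allSubsets [] = here refl
∈-allSubsets {suc n} (true ∷ σ) = ∈-++⁺ˡ (∈-map⁺ (true ∷_) (∈-allSubsets σ))
∈-allSubsets {suc n} (false ∷ σ) = ∈-++⁺ʳ (map (true ∷_) (allSubsets n)) (∈-map⁺ (false ∷_) (∈-allSubsets σ))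

count-++ : ∀ {n} (P Q : List (Subset n)) σ → count (P ++ Q) σ ≡ count P σ +ℕ count Q σ
count-++ P Q σ = trans (cong List.length (filter-++ (T? ∘ (σ ⊆ᵇ_)) P Q)) (length-++ (filterᵇ (σ ⊆ᵇ_) P))

filterᵇ-empty-or-witness : ∀ {A : Set} (q : A → Bool) xs →
  List.length (filterᵇ q xs) ≡ 0 ⊎ Σ A (λ x → x ∈ xs × T (q x))
filterᵇ-empty-or-witness q xs with filterᵇ q xs in eq
... | []    = inj₁ refl
... | x ∷ _ = inj₂ (x , ∈-filter⁻ (T? ∘ q) (subst (x ∈_) (sym eq) (here refl)))

length-filterᵇ-filterᵇ : ∀ {A : Set} (q k : A → Bool) xs →
  List.length (filterᵇ q (filterᵇ k xs)) ≤ℕ List.length (filterᵇ q xs)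
length-filterᵇ-filterᵇ q k [] = z≤n
length-filterᵇ-filterᵇ q k (x ∷ xs) with k x
... | true with q x
...   | true  = s≤s (length-filterᵇ-filterᵇ q k xs)
...   | false = length-filterᵇ-filterᵇ q k xs
length-filterᵇ-filterᵇ q k (x ∷ xs) | false with q x
...   | true  = ℕP.m≤n⇒m≤1+n (length-filterᵇ-filterᵇ q k xs)
...   | false = length-filterᵇ-filterᵇ q k xs

length-filterᵇ-map : ∀ {A B : Set} (q : B → Bool) (q' c : A → Bool) (h : A → B) xs →
  (∀ x → T (c x) → T (q (h x)) → T (q' x)) →
  List.length (filterᵇ q (map h (filterᵇ c xs))) ≤ℕ List.length (filterᵇ q' xs)
length-filterᵇ-map q q' c h [] _ = z≤n
length-filterᵇ-map q q' c h (x ∷ xs) imp with c x in cx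
... | false with q' x
...   | true  = ℕP.m≤n⇒m≤1+n (length-filterᵇ-map q q' c h xs imp)
...   | false = length-filterᵇ-map q q' c h xs imp
length-filterᵇ-map q q' c h (x ∷ xs) imp | true with q (h x) in qhx
...   | true rewrite Equivalence.to T-≡ (imp x (subst T (sym cx) tt) (subst T (sym qhx) tt)) =
        s≤s (length-filterᵇ-map q q' c h xs imp)
...   | false with q' x
...     | true  = ℕP.m≤n⇒m≤1+n (length-filterᵇ-map q q' c h xs imp)
...     | false = length-filterᵇ-map q q' c h xs imp

maxOf : ∀ {A : Set} → (A → ℕ) → List A → ℕ
maxOf f xs = List.foldr _⊔_ 0 (map f xs)

≤-maxOf : ∀ {A : Set} (f : A → ℕ) {x} xs → x ∈ xs → f x ≤ℕ maxOf f xs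
≤-maxOf f (y ∷ xs) (here refl) = ℕP.m≤m⊔n (f y) _
≤-maxOf f (y ∷ xs) (there x∈xs) = ℕP.≤-trans (≤-maxOf f xs x∈xs) (ℕP.m≤n⊔m (f y) _)

maxOf-lub : ∀ {A : Set} (f : A → ℕ) xs {b} → (∀ {x} → x ∈ xs → f x ≤ℕ b) → maxOf f xs ≤ℕ b
maxOf-lub f [] _ = z≤n
maxOf-lub f (y ∷ xs) bound = ℕP.⊔-lub (bound (here refl)) (maxOf-lub f xs (bound ∘ there))

-- The run is given
-- by any g with g i ≡ j + i, since applyUpTo shifts its function.
foldl-run : ∀ {B : Set} (f : B → ℕ → B) (Q : ℕ → B → Set) {j₀} →
  (∀ {j b} → j₀ ≤ℕ j → Q j b → Q (suc j) (f b j)) →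
  ∀ k (g : ℕ → ℕ) {j b} → (∀ i → g i ≡ j +ℕ i) → j₀ ≤ℕ j → Q j b →
  Q (k +ℕ j) (List.foldl f b (applyUpTo g k))
foldl-run f Q next zero g _ _ q = q
foldl-run f Q {j₀} next (suc k) g {j} {b} g≡ j₀≤j q =
  subst (λ i → Q i (List.foldl f (f b (g 0)) (applyUpTo (g ∘ suc) k))) (ℕP.+-suc k j)
    (foldl-run f Q next k (g ∘ suc) (λ i → trans (g≡ (suc i)) (ℕP.+-suc j i)) (ℕP.m≤n⇒m≤1+n j₀≤j)
      (subst (λ i → Q (suc j) (f b i)) (sym (trans (g≡ 0) (ℕP.+-identityʳ j))) (next j₀≤j q)))

foldl-vertices : ∀ {B : Set} {n} (f : B → Fin n → B) (Q : ℕ → B → Set) →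
  (∀ {w b v} → toℕ v ≡ w → Q w b → Q (suc w) (f b v)) →
  ∀ k (g : Fin k → Fin n) {w b} → (∀ i → toℕ (g i) ≡ w +ℕ toℕ i) → Q w b →
  Q (k +ℕ w) (List.foldl f b (List.tabulate g))
foldl-vertices f Q next zero g _ q = q
foldl-vertices f Q next (suc k) g {w} {b} g≡ q =
  subst (λ i → Q i (List.foldl f (f b (g Fin.zero)) (List.tabulate (g ∘ Fin.suc)))) (ℕP.+-suc k w)
    (foldl-vertices f Q next k (g ∘ Fin.suc) (λ i → trans (g≡ (Fin.suc i)) (ℕP.+-suc w (toℕ i)))
      (next (trans (g≡ Fin.zero) (ℕP.+-identityʳ w)) q))

if-elim : ∀ {A : Set} (Q : A → Set) b {x y : A} → Q x → Q y → Q (if b then x else y)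
if-elim Q true qx qy = qx
if-elim Q false qx qy = qy

if-≡ᵇ-equal : ∀ {A : Set} {t s} {x y : A} → t ≡ s → (if t ≡ᵇ s then x else y) ≡ x
if-≡ᵇ-equal {t = t} {s} t≡s rewrite Equivalence.to T-≡ (ℕP.≡⇒≡ᵇ t s t≡s) = refl

if-≡ᵇ-other : ∀ {A : Set} {t s} {x y : A} → t ≢ s → (if t ≡ᵇ s then x else y) ≡ y
if-≡ᵇ-other {t = t} {s} t≢s with t ≡ᵇ s in eq
... | true  = ⊥-elim (t≢s (ℕP.≡ᵇ⇒≡ t s (subst T (sym eq) tt)))
... | false = refl

module Container {r n : ℕ} (2≤r : 2 ≤ℕ r) (G : RGraph r n) (τ ζ : ℚ) (0≤τ : 0ℚ ≤ τ) where
  open Algo G τ ζ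
  open ProfileSums τ 0≤τ

  degProfile : ℕ → Subset n → ℕ → ℚ
  degProfile k σ ℓ = ℕ→ℚ (degMax G (k +ℕ ℓ) σ)

  degProfile-nonneg : ∀ k σ ℓ → 0ℚ ≤ degProfile k σ ℓ
  degProfile-nonneg k σ ℓ = ℕ→ℚ-nonneg (degMax G (k +ℕ ℓ) σ)

  bound : ℕ → Subset n → ℚ
  bound s σ = two^ (r C 2) * bndSum (r ∸ s) s (degProfile ∣ σ ∣ σ)

  -- θ_s(σ) as a function of k = |σ| ≥ 2 (smaller k are irrelevant here).
  -- Going through it, the case analysis on |σ| below compares θ with a term
  -- that is itself stuck on the size, instead of with an unfolded sum.
  θ-bySize : ℕ → Subset n → ℕ → ℚ
  θ-bySize s σ (suc (suc k)) = two^ (r C 2) * thrSum (r ∸ s) s (degProfile (suc (suc k)) σ)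
  θ-bySize s σ _ = 0ℚ

  θ≡thrSum : ∀ s σ → 2 ≤ℕ ∣ σ ∣ → θ G τ s σ ≡ two^ (r C 2) * thrSum (r ∸ s) s (degProfile ∣ σ ∣ σ)
  θ≡thrSum s σ 2≤∣σ∣ = trans (θ≡bySize 2≤∣σ∣) (bySize-large ∣ σ ∣ 2≤∣σ∣)
    where
    θ≡bySize : 2 ≤ℕ ∣ σ ∣ → θ G τ s σ ≡ θ-bySize s σ ∣ σ ∣
    θ≡bySize 2≤∣σ∣ with ∣ σ ∣ | 2≤∣σ∣
    ... | suc (suc k) | _ = refl
    ... | suc zero | s≤s ()
    bySize-large : ∀ k → 2 ≤ℕ k → θ-bySize s σ k ≡ two^ (r C 2) * thrSum (r ∸ s) s (degProfile k σ)
    bySize-large (suc (suc k)) _ = refl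
    bySize-large (suc zero) (s≤s ())

  bound-nonneg : ∀ s σ → 0ℚ ≤ bound s σ
  bound-nonneg s σ = *-nonneg (two^-nonneg (r C 2)) (bndSum-nonneg (r ∸ s) s _ (degProfile-nonneg ∣ σ ∣ σ))

  θ-nonneg : ∀ s σ → 2 ≤ℕ ∣ σ ∣ → 0ℚ ≤ θ G τ s σ
  θ-nonneg s σ 2≤∣σ∣ = subst (0ℚ ≤_) (sym (θ≡thrSum s σ 2≤∣σ∣))
    (*-nonneg (two^-nonneg (r C 2)) (thrSum-nonneg (r ∸ s) s _ (degProfile-nonneg ∣ σ ∣ σ)))

  -- d^{(j)} is antitone in σ: a larger σ has fewer supersets to maximise over.
  degMax-antitone : ∀ j {σ σ'} → σ ⊆ σ' → degMax G j σ' ≤ℕ degMax G j σ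
  degMax-antitone j {σ} {σ'} σ⊆σ' = maxOf-lub (deg G) (filterᵇ (candidate σ') (allSubsets n)) λ x∈ →
    let x∈all , test = ∈-filter⁻ (T? ∘ candidate σ') {xs = allSubsets n} x∈
        σ'⊆x , size = Equivalence.to T-∧ test
    in ≤-maxOf (deg G) (filterᵇ (candidate σ) (allSubsets n)) (∈-filter⁺ (T? ∘ candidate σ) x∈all
         (Equivalence.from T-∧ (⊆⇒⊆ᵇ (⊆-trans σ⊆σ' (⊆ᵇ⇒⊆ σ'⊆x)) , size)))
    where
    candidate : Subset n → Subset n → Bool
    candidate σ x = (σ ⊆ᵇ x) ∧ (∣ x ∣ ≡ᵇ j)

  deg≤degMax : ∀ σ → deg G σ ≤ℕ degMax G ∣ σ ∣ σ
  deg≤degMax σ = ≤-maxOf (deg G) _ (∈-filter⁺ (T? ∘ λ x → (σ ⊆ᵇ x) ∧ (∣ x ∣ ≡ᵇ ∣ σ ∣)) (∈-allSubsets σ)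
    (Equivalence.from T-∧ (⊆⇒⊆ᵇ {σ = σ} ⊆-refl , ℕP.≡⇒≡ᵇ ∣ σ ∣ ∣ σ ∣ refl)))

  degProfile-shift : ∀ σ {v} → v ∉ σ → ∀ ℓ →
    degProfile (∣ σ ∪ ⁅ v ⁆ ∣) (σ ∪ ⁅ v ⁆) ℓ ≤ degProfile ∣ σ ∣ σ (suc ℓ)
  degProfile-shift σ {v} v∉σ ℓ = ℕ→ℚ-mono (subst (λ j → degMax G j (σ ∪ ⁅ v ⁆) ≤ℕ degMax G (∣ σ ∣ +ℕ suc ℓ) σ)
    (sym (trans (cong (_+ℕ ℓ) (∣∪⁅⁆∣ σ v∉σ)) (sym (ℕP.+-suc ∣ σ ∣ ℓ))))
    (degMax-antitone (∣ σ ∣ +ℕ suc ℓ) (p⊆p∪q {p = σ} ⁅ v ⁆)))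

  r∸s≡suc : ∀ {s} → s <ℕ r → r ∸ s ≡ suc (r ∸ suc s)
  r∸s≡suc s<r = ℕP.+-∸-assoc 1 s<r

  θ+bound≤bound : ∀ s σ {v} → s <ℕ r → 2 ≤ℕ ∣ σ ∣ → v ∉ σ →
                  θ G τ s σ + bound (suc s) (σ ∪ ⁅ v ⁆) ≤ bound s σ
  θ+bound≤bound s σ {v} s<r 2≤∣σ∣ v∉σ = begin
    θ G τ s σ + bound (suc s) σ'
      ≡⟨ cong (_+ bound (suc s) σ') (θ≡thrSum s σ 2≤∣σ∣) ⟩
    A * thrSum (r ∸ s) s D + A * bndSum m (suc s) D'
      ≡⟨ cong (λ k → A * thrSum k s D + A * bndSum m (suc s) D') (r∸s≡suc s<r) ⟩
    A * thrSum (suc m) s D + A * bndSum m (suc s) D'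
      ≡⟨ sym (ℚP.*-distribˡ-+ A _ _) ⟩
    A * (thrSum (suc m) s D + bndSum m (suc s) D')
      ≤⟨ *-monoˡ-≤-nonneg (two^-nonneg (r C 2)) (absorb m s D D' (degProfile-nonneg ∣ σ ∣ σ) (degProfile-shift σ v∉σ)) ⟩
    A * bndSum (suc m) s D
      ≡⟨ cong (λ k → A * bndSum k s D) (sym (r∸s≡suc s<r)) ⟩
    bound s σ ∎
    where
    open ℚP.≤-Reasoning
    A = two^ (r C 2)
    m = r ∸ suc s
    σ' = σ ∪ ⁅ v ⁆
    D = degProfile ∣ σ ∣ σ
    D' = degProfile ∣ σ' ∣ σ'

  scaled-bound≤θ : ∀ s σ → suc s ≤ℕ r → 2 ≤ℕ ∣ σ ∣ → (two^ s * τ) * bound (suc s) σ ≤ θ G τ s σ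
  scaled-bound≤θ s σ s<r 2≤∣σ∣ = begin
    (two^ s * τ) * (A * bndSum m (suc s) D)
      ≡⟨ solve 3 (λ c a x → c :* (a :* x) := a :* (c :* x)) refl (two^ s * τ) A _ ⟩
    A * ((two^ s * τ) * bndSum m (suc s) D)
      ≤⟨ *-monoˡ-≤-nonneg (two^-nonneg (r C 2)) (dominate m s D (degProfile-nonneg ∣ σ ∣ σ)) ⟩
    A * thrSum (suc m) s D
      ≡⟨ cong (λ k → A * thrSum k s D) (sym (r∸s≡suc s<r)) ⟩
    A * thrSum (r ∸ s) s D
      ≡⟨ sym (θ≡thrSum s σ 2≤∣σ∣) ⟩
    θ G τ s σ ∎
    where
    open ℚP.≤-Reasoning
    A = two^ (r C 2)
    m = r ∸ suc s
    D = degProfile ∣ σ ∣ σ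

  deg≤bound : ∀ σ → ℕ→ℚ (deg G σ) ≤ bound r σ
  deg≤bound σ = begin
    ℕ→ℚ (deg G σ)                                   ≤⟨ ℕ→ℚ-mono (subst (λ j → deg G σ ≤ℕ degMax G j σ)
                                                          (sym (ℕP.+-identityʳ ∣ σ ∣)) (deg≤degMax σ)) ⟩
    degProfile ∣ σ ∣ σ 0                            ≡⟨ sym (bndSum-depth0 r (degProfile ∣ σ ∣ σ)) ⟩
    two^ (r C 2) * bndSum 0 r (degProfile ∣ σ ∣ σ)  ≡⟨ cong (λ k → two^ (r C 2) * bndSum k r (degProfile ∣ σ ∣ σ))
                                                          (sym (ℕP.n∸n≡0 r)) ⟩
    bound r σ ∎
    where open ℚP.≤-Reasoning

  covered : List (Subset n) → Subset n → Set
  covered Γs σ = T (any (λ γ → γ ⊆ᵇ σ) Γs)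

  covered⁺ : ∀ {Γs γ σ} → γ ∈ Γs → γ ⊆ σ → covered Γs σ
  covered⁺ γ∈Γs γ⊆σ = any⁺ _ (lose γ∈Γs (⊆⇒⊆ᵇ γ⊆σ))

  covered-⊆ : ∀ Γs {σ σ'} → σ ⊆ σ' → covered Γs σ → covered Γs σ'
  covered-⊆ Γs σ⊆σ' cov =
    let γ , γ∈Γs , γ⊆σ = find (any⁻ _ Γs cov) in covered⁺ γ∈Γs (⊆-trans (⊆ᵇ⇒⊆ γ⊆σ) σ⊆σ')

  module Vertex (st : State G) (v : Fin n) where

    -- p ∈ P_{s+1} yields p ∖ {v} ∈ F_{v,s} when it passes this test
    -- (and p ∖ {v} is not covered by Γ_s).
    link : Subset n → Bool
    link p = lookup p v ∧ ((p ∖ ⁅ v ⁆) ⊆ᵇ above v)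

    uncovered : ℕ → Subset n → Bool
    uncovered s f = not (any (λ γ → γ ⊆ᵇ f) (Γ st s))

    F-member : ∀ s {σ f} → f ∈ F st v s → σ ⊆ f → σ ⊆ above v × ¬ covered (Γ st s) σ
    F-member s {σ} {f} f∈F σ⊆f = ⊆-trans σ⊆f f⊆above , σ-uncovered
      where
      f∈images = ∈-filter⁻ (T? ∘ uncovered s) {xs = map (_∖ ⁅ v ⁆) (filterᵇ link (P st (suc s)))} f∈F
      preimage = ∈-map⁻ (_∖ ⁅ v ⁆) (proj₁ f∈images)
      linked : T (link (proj₁ preimage))
      linked = proj₂ (∈-filter⁻ (T? ∘ link) {xs = P st (suc s)} (proj₁ (proj₂ preimage)))
      f⊆above : f ⊆ above v
      f⊆above = subst (_⊆ above v) (sym (proj₂ (proj₂ preimage))) (⊆ᵇ⇒⊆ (proj₂ (Equivalence.to T-∧ linked)))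
      σ-uncovered : ¬ covered (Γ st s) σ
      σ-uncovered cov = subst T (Equivalence.to T-not-≡ (proj₂ f∈images)) (covered-⊆ (Γ st s) σ⊆f cov)

    -- Each member of F_{v,s} containing σ comes from a distinct member of
    -- P_{s+1} containing σ ∪ {v}.
    count-F≤ : ∀ s σ → count (F st v s) σ ≤ℕ count (P st (suc s)) (σ ∪ ⁅ v ⁆)
    count-F≤ s σ = ℕP.≤-trans
      (length-filterᵇ-filterᵇ (σ ⊆ᵇ_) (uncovered s) (map (_∖ ⁅ v ⁆) (filterᵇ link (P st (suc s)))))
      (length-filterᵇ-map (σ ⊆ᵇ_) ((σ ∪ ⁅ v ⁆) ⊆ᵇ_) link (_∖ ⁅ v ⁆) (P st (suc s)) contains)
      where
      contains : ∀ p → T (link p) → T (σ ⊆ᵇ (p ∖ ⁅ v ⁆)) → T ((σ ∪ ⁅ v ⁆) ⊆ᵇ p)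
      contains p linked σ⊆p∖v = ⊆⇒⊆ᵇ λ u∈ → [ (λ u∈σ → ∖-⊆ p ⁅ v ⁆ (⊆ᵇ⇒⊆ σ⊆p∖v u∈σ))
                                              , (λ u∈⁅v⁆ → subst (_∈ˢ p) (sym (x∈⁅y⁆⇒x≡y v u∈⁅v⁆))
                                                               (lookup⇒∈ (proj₁ (Equivalence.to T-∧ linked)))) ]′
                                            (x∈p∪q⁻ σ ⁅ v ⁆ u∈)

    grown : ℕ → List (Subset n)
    grown t = P st t ++ F st v t

    newΓ-test : ℕ → List (Subset n) → Subset n → Bool
    newΓ-test t Pt σ = (σ ⊆ᵇ above v) ∧ (1 ≤ℕᵇ ∣ σ ∣) ∧ (∣ σ ∣ ≤ℕᵇ t) ∧ (θ G τ t σ ≤ᵇ ℕ→ℚ (count Pt σ))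

    newΓ-for : ℕ → List (Subset n) → List (Subset n)
    newΓ-for t Pt = filterᵇ (newΓ-test t Pt) (allSubsets n)

    newΓ : ℕ → List (Subset n)
    newΓ t = newΓ-for t (grown t)

    newΓ⁺ : ∀ t {σ} → σ ⊆ above v → 1 ≤ℕ ∣ σ ∣ → ∣ σ ∣ ≤ℕ t →
            T (θ G τ t σ ≤ᵇ ℕ→ℚ (count (grown t) σ)) → σ ∈ newΓ t
    newΓ⁺ t {σ} σ⊆above 1≤∣σ∣ ∣σ∣≤t reached = ∈-filter⁺ (T? ∘ newΓ-test t (grown t)) (∈-allSubsets σ)
      (Equivalence.from T-∧ (⊆⇒⊆ᵇ σ⊆above ,
       Equivalence.from T-∧ (ℕP.≤⇒≤ᵇ 1≤∣σ∣ , Equivalence.from T-∧ (ℕP.≤⇒≤ᵇ ∣σ∣≤t , reached))))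

    newΓ⁻ : ∀ t {σ} → σ ∈ newΓ t → θ G τ t σ ≤ ℕ→ℚ (count (grown t) σ)
    newΓ⁻ t {σ} σ∈newΓ = ℚP.≤ᵇ⇒≤ reached
      where
      test = proj₂ (∈-filter⁻ (T? ∘ newΓ-test t (grown t)) {xs = allSubsets n} σ∈newΓ)
      rest₁ = proj₂ (Equivalence.to (T-∧ {σ ⊆ᵇ above v}) test)
      rest₂ = proj₂ (Equivalence.to (T-∧ {1 ≤ℕᵇ ∣ σ ∣}) rest₁)
      reached = proj₂ (Equivalence.to (T-∧ {∣ σ ∣ ≤ℕᵇ t}) rest₂)

    record LevelsDone (j : ℕ) (st' : State G) : Set where
      field
        updated   : ∀ {t} → 1 ≤ℕ t → t <ℕ j → P st' t ≡ grown t × Γ st' t ≡ Γ st t ++ newΓ t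
        untouched : ∀ {t} → t ≡ 0 ⊎ j ≤ℕ t → P st' t ≡ P st t × Γ st' t ≡ Γ st t
    open LevelsDone

    levelsDone-step : ∀ {j st'} → 1 ≤ℕ j → LevelsDone j st' → LevelsDone (suc j) (updateS v (F st v) st' j)
    updated (levelsDone-step {j} {st'} 1≤j done) {t} 1≤t t<j+1 =
      [ (λ t≡j → subst (λ i → P st'' i ≡ grown i × Γ st'' i ≡ Γ st i ++ newΓ i) (sym t≡j) level-j)
      , (λ t≢j → let earlier = updated done 1≤t (ℕP.≤∧≢⇒< (ℕP.≤-pred t<j+1) t≢j) in
                 trans (if-≡ᵇ-other t≢j) (proj₁ earlier) , trans (if-≡ᵇ-other t≢j) (proj₂ earlier))
      ]′ (toSum (t ℕ.≟ j))
      where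
      st'' = updateS v (F st v) st' j
      eP : P st' j ≡ P st j
      eP = proj₁ (untouched done (inj₂ ℕP.≤-refl))
      eΓ : Γ st' j ≡ Γ st j
      eΓ = proj₂ (untouched done (inj₂ ℕP.≤-refl))
      level-j : P st'' j ≡ grown j × Γ st'' j ≡ Γ st j ++ newΓ j
      level-j = trans (if-≡ᵇ-equal {t = j} refl) (cong (_++ F st v j) eP)
              , trans (if-≡ᵇ-equal {t = j} refl) (cong₂ (λ Γj Pj → Γj ++ newΓ-for j (Pj ++ F st v j)) eΓ eP)
    untouched (levelsDone-step {j} {st'} 1≤j done) {t} outside =
      trans (if-≡ᵇ-other t≢j) (proj₁ earlier) , trans (if-≡ᵇ-other t≢j) (proj₂ earlier)
      where
      t≢j : t ≢ j
      t≢j refl = [ (λ t≡0 → ℕP.<-irrefl (sym t≡0) 1≤j) , ℕP.<-irrefl refl ]′ outside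
      earlier = untouched done ([ inj₁ , (λ j<t → inj₂ (ℕP.<⇒≤ j<t)) ]′ outside)

    levelsDone-all : ∀ st₁ → P st₁ ≡ P st → Γ st₁ ≡ Γ st →
                     LevelsDone r (List.foldl (updateS v (F st v)) st₁ sRange)
    levelsDone-all st₁ eP eΓ =
      subst₂ (λ j levels → LevelsDone j (List.foldl (updateS v (F st v)) st₁ levels))
        (ℕP.m∸n+n≡m (ℕP.≤-trans (s≤s z≤n) 2≤r)) (sym (map-upTo suc (r ∸ 1)))
        (foldl-run (updateS v (F st v)) LevelsDone levelsDone-step (r ∸ 1) suc (λ _ → refl) ℕP.≤-refl start)
      where
      start : LevelsDone 1 st₁
      updated start 1≤t t<1 = ⊥-elim (ℕP.<-irrefl refl (ℕP.≤-trans t<1 1≤t))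
      untouched start {t} _ = cong-app eP t , cong-app eΓ t

  -- The invariant maintained while the vertices are processed in turn,
  -- stated for the families P_s and Γ_s once the vertices below w are done:
  --   * every d_s(σ) respects the claimed bound;
  --   * a σ lying above the processed vertices and not covered by Γ_s has
  --     d_s(σ) at most its threshold (so adding F_{v,s} keeps the bound);
  --   * every member of Γ_s has reached its threshold.
  record Invariant (w : ℕ) (Pf Γf : ℕ → List (Subset n)) : Set where
    field
      bounded : ∀ s → 2 ≤ℕ s → s ≤ℕ r → ∀ σ → 2 ≤ℕ ∣ σ ∣ → ∣ σ ∣ ≤ℕ s →
                ℕ→ℚ (count (Pf s) σ) ≤ bound s σ
      below-threshold : ∀ s → s <ℕ r → ∀ σ → 2 ≤ℕ ∣ σ ∣ → ∣ σ ∣ ≤ℕ s →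
                        (∀ {u} → u ∈ˢ σ → w ≤ℕ toℕ u) → ¬ covered (Γf s) σ →
                        ℕ→ℚ (count (Pf s) σ) ≤ θ G τ s σ
      saturated : ∀ s σ → σ ∈ Γf s → θ G τ s σ ≤ ℕ→ℚ (count (Pf s) σ)
  open Invariant

  -- Skipping a vertex keeps the families and only shrinks the range of σ
  -- in below-threshold.
  skip : ∀ {w Pf Γf} → Invariant w Pf Γf → Invariant (suc w) Pf Γf
  bounded (skip inv) = bounded inv
  below-threshold (skip inv) s s<r σ 2≤∣σ∣ ∣σ∣≤s past = below-threshold inv s s<r σ 2≤∣σ∣ ∣σ∣≤s (ℕP.<⇒≤ ∘ past)
  saturated (skip inv) = saturated inv

  level-cases : ∀ t → (1 ≤ℕ t × t <ℕ r) ⊎ (t ≡ 0 ⊎ r ≤ℕ t)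
  level-cases zero = inj₂ (inj₁ refl)
  level-cases (suc t) = [ (λ t<r → inj₁ (s≤s z≤n , t<r)) , (λ t≮r → inj₂ (inj₂ (ℕP.≮⇒≥ t≮r))) ]′
                          (toSum (suc t ℕ.<? r))

  1≤level : ∀ {k s} → 2 ≤ℕ k → k ≤ℕ s → 1 ≤ℕ s
  1≤level 2≤k k≤s = ℕP.≤-trans (ℕP.≤-trans (s≤s z≤n) 2≤k) k≤s

  module Update (w : ℕ) (st : State G) (v : Fin n) (v≡w : toℕ v ≡ w)
                (inv : Invariant w (P st) (Γ st))
                (st' : State G) (done : Vertex.LevelsDone st v r st') where
    open Vertex st v
    open LevelsDone done

    -- If
    -- some member of F_{v,s} contains σ, then σ lies above v and is uncovered,
    -- so the old d_s(σ) is at most θ_s(σ), and the new members are counted by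
    -- d_{s+1}(σ ∪ {v}) ≤ bound_{s+1}(σ ∪ {v}); absorption finishes.
    grown-bounded : ∀ s → 2 ≤ℕ s → s <ℕ r → ∀ σ → 2 ≤ℕ ∣ σ ∣ → ∣ σ ∣ ≤ℕ s →
                    ℕ→ℚ (count (grown s) σ) ≤ bound s σ
    grown-bounded s 2≤s s<r σ 2≤∣σ∣ ∣σ∣≤s = begin
      ℕ→ℚ (count (grown s) σ)          ≡⟨ cong ℕ→ℚ (count-++ (P st s) (F st v s) σ) ⟩
      ℕ→ℚ (old +ℕ new)                 ≡⟨ ℕ→ℚ-+ old new ⟩
      ℕ→ℚ old + ℕ→ℚ new                ≤⟨ [ no-new , some-new ]′ (filterᵇ-empty-or-witness (σ ⊆ᵇ_) (F st v s)) ⟩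
      bound s σ ∎
      where
      open ℚP.≤-Reasoning
      old new : ℕ
      old = count (P st s) σ
      new = count (F st v s) σ
      old≤bound : ℕ→ℚ old ≤ bound s σ
      old≤bound = bounded inv s 2≤s (ℕP.<⇒≤ s<r) σ 2≤∣σ∣ ∣σ∣≤s
      no-new : new ≡ 0 → ℕ→ℚ old + ℕ→ℚ new ≤ bound s σ
      no-new new≡0 = begin
        ℕ→ℚ old + ℕ→ℚ new  ≡⟨ cong (λ k → ℕ→ℚ old + ℕ→ℚ k) new≡0 ⟩
        ℕ→ℚ old + ℕ→ℚ 0    ≡⟨ cong (ℕ→ℚ old +_) ℕ→ℚ-0 ⟩
        ℕ→ℚ old + 0ℚ       ≡⟨ ℚP.+-identityʳ (ℕ→ℚ old) ⟩
        ℕ→ℚ old            ≤⟨ old≤bound ⟩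
        bound s σ ∎
      some-new : Σ (Subset n) (λ f → f ∈ F st v s × T (σ ⊆ᵇ f)) → ℕ→ℚ old + ℕ→ℚ new ≤ bound s σ
      some-new (f , f∈F , σ⊆f) = begin
        ℕ→ℚ old + ℕ→ℚ new             ≤⟨ ℚP.+-mono-≤ old≤θ new≤bound ⟩
        θ G τ s σ + bound (suc s) σ'  ≤⟨ θ+bound≤bound s σ s<r 2≤∣σ∣ v∉σ ⟩
        bound s σ ∎
        where
        σ' = σ ∪ ⁅ v ⁆
        σ⊆above : σ ⊆ above v
        σ⊆above = proj₁ (F-member s f∈F (⊆ᵇ⇒⊆ σ⊆f))
        v∉σ : v ∉ σ
        v∉σ = ∉-above v σ⊆above
        old≤θ : ℕ→ℚ old ≤ θ G τ s σ
        old≤θ = below-threshold inv s s<r σ 2≤∣σ∣ ∣σ∣≤s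
                  (λ u∈σ → subst (_≤ℕ _) v≡w (ℕP.<⇒≤ (∈-above⁻ v (σ⊆above u∈σ))))
                  (proj₂ (F-member s f∈F (⊆ᵇ⇒⊆ σ⊆f)))
        ∣σ'∣≡ : ∣ σ' ∣ ≡ suc ∣ σ ∣
        ∣σ'∣≡ = ∣∪⁅⁆∣ σ v∉σ
        new≤bound : ℕ→ℚ new ≤ bound (suc s) σ'
        new≤bound = ℚP.≤-trans (ℕ→ℚ-mono (count-F≤ s σ))
          (bounded inv (suc s) (ℕP.m≤n⇒m≤1+n 2≤s) s<r σ'
            (subst (2 ≤ℕ_) (sym ∣σ'∣≡) (ℕP.m≤n⇒m≤1+n 2≤∣σ∣)) (subst (_≤ℕ suc s) (sym ∣σ'∣≡) (s≤s ∣σ∣≤s)))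

    bounded' : ∀ s → 2 ≤ℕ s → s ≤ℕ r → ∀ σ → 2 ≤ℕ ∣ σ ∣ → ∣ σ ∣ ≤ℕ s →
               ℕ→ℚ (count (P st' s) σ) ≤ bound s σ
    bounded' s 2≤s s≤r σ 2≤∣σ∣ ∣σ∣≤s =
      [ (λ (1≤s , s<r) → subst (λ Ps → ℕ→ℚ (count Ps σ) ≤ bound s σ) (sym (proj₁ (updated 1≤s s<r)))
                                (grown-bounded s 2≤s s<r σ 2≤∣σ∣ ∣σ∣≤s))
      , (λ outside → subst (λ Ps → ℕ→ℚ (count Ps σ) ≤ bound s σ) (sym (proj₁ (untouched outside)))
                           (bounded inv s 2≤s s≤r σ 2≤∣σ∣ ∣σ∣≤s))
      ]′ (level-cases s)

    -- A σ above v that stayed uncovered was not added to Γ_s, so it is below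
    -- its threshold with respect to the grown P_s.
    below-threshold' : ∀ s → s <ℕ r → ∀ σ → 2 ≤ℕ ∣ σ ∣ → ∣ σ ∣ ≤ℕ s →
                       (∀ {u} → u ∈ˢ σ → suc w ≤ℕ toℕ u) → ¬ covered (Γ st' s) σ →
                       ℕ→ℚ (count (P st' s) σ) ≤ θ G τ s σ
    below-threshold' s s<r σ 2≤∣σ∣ ∣σ∣≤s past uncovered' =
      subst (λ Ps → ℕ→ℚ (count Ps σ) ≤ θ G τ s σ) (sym (proj₁ level-s))
        ([ (λ reached → ⊥-elim (uncovered' (subst (λ Γs → covered Γs σ) (sym (proj₂ level-s))
                                  (covered⁺ (∈-++⁺ʳ (Γ st s) (newΓ⁺ s σ⊆above (1≤level ℕP.≤-refl 2≤∣σ∣) ∣σ∣≤s reached))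
                                            (⊆-refl {x = σ})))))
         , (λ unreached → ℚP.<⇒≤ (ℚP.≰⇒> (unreached ∘ ℚP.≤⇒≤ᵇ)))
         ]′ (toSum (T? (θ G τ s σ ≤ᵇ ℕ→ℚ (count (grown s) σ)))))
      where
      level-s : P st' s ≡ grown s × Γ st' s ≡ Γ st s ++ newΓ s
      level-s = updated (1≤level 2≤∣σ∣ ∣σ∣≤s) s<r
      σ⊆above : σ ⊆ above v
      σ⊆above u∈σ = ∈-above⁺ v (subst (λ k → suc k ≤ℕ _) (sym v≡w) (past u∈σ))

    -- Old members of Γ_t only gained count; new ones passed the threshold test.
    saturated' : ∀ t σ → σ ∈ Γ st' t → θ G τ t σ ≤ ℕ→ℚ (count (P st' t) σ)
    saturated' t σ σ∈Γ = [ touched , unchanged ]′ (level-cases t)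
      where
      touched : 1 ≤ℕ t × t <ℕ r → θ G τ t σ ≤ ℕ→ℚ (count (P st' t) σ)
      touched (1≤t , t<r) = subst (λ Ps → θ G τ t σ ≤ ℕ→ℚ (count Ps σ)) (sym (proj₁ level-t))
        ([ was-member , newΓ⁻ t ]′ (∈-++⁻ (Γ st t) (subst (σ ∈_) (proj₂ level-t) σ∈Γ)))
        where
        level-t = updated 1≤t t<r
        was-member : σ ∈ Γ st t → θ G τ t σ ≤ ℕ→ℚ (count (grown t) σ)
        was-member σ∈old = ℚP.≤-trans (saturated inv t σ σ∈old) (ℕ→ℚ-mono
          (subst (count (P st t) σ ≤ℕ_) (sym (count-++ (P st t) (F st v t) σ))
                 (ℕP.m≤m+n (count (P st t) σ) (count (F st v t) σ))))
      unchanged : t ≡ 0 ⊎ r ≤ℕ t → θ G τ t σ ≤ ℕ→ℚ (count (P st' t) σ)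
      unchanged outside = subst (λ Ps → θ G τ t σ ≤ ℕ→ℚ (count Ps σ)) (sym (proj₁ (untouched outside)))
        (saturated inv t σ (subst (σ ∈_) (proj₂ (untouched outside)) σ∈Γ))

    invariant' : Invariant (suc w) (P st') (Γ st')
    invariant' = record { bounded = bounded' ; below-threshold = below-threshold' ; saturated = saturated' }

  modeAct-keeps : ∀ m v st → P (modeAct m v st) ≡ P st × Γ (modeAct m v st) ≡ Γ st
  modeAct-keeps (prune _) v st = refl , refl
  modeAct-keeps (build _) v st = refl , refl

  step-preserves : ∀ m {w st v} → toℕ v ≡ w → Invariant w (P st) (Γ st) →
                   Invariant (suc w) (P (step m st v)) (Γ (step m st v))
  step-preserves m {w} {st} {v} v≡w inv =
    if-elim Inv' (triggered st v)
      (if-elim Inv' (lookup (State.T st₁) v)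
        (Update.invariant' w st v v≡w inv _
          (Vertex.levelsDone-all st v st₁ (proj₁ (modeAct-keeps m v st)) (proj₂ (modeAct-keeps m v st))))
        (subst₂ (Invariant (suc w)) (sym (proj₁ (modeAct-keeps m v st))) (sym (proj₂ (modeAct-keeps m v st)))
          (skip inv)))
      (skip inv)
    where
    Inv' : State G → Set
    Inv' x = Invariant (suc w) (P x) (Γ x)
    st₁ = modeAct m v st

  initial : ∀ m → Invariant 0 (P (initState G m)) (Γ (initState G m))
  bounded (initial m) s 2≤s s≤r σ _ _ =
    [ (λ s≡r → subst (λ Ps → ℕ→ℚ (count Ps σ) ≤ bound s σ) (sym (if-≡ᵇ-equal s≡r))
                     (subst (λ k → ℕ→ℚ (deg G σ) ≤ bound k σ) (sym s≡r) (deg≤bound σ)))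
    , (λ s≢r → subst (λ Ps → ℕ→ℚ (count Ps σ) ≤ bound s σ) (sym (if-≡ᵇ-other s≢r))
                     (subst (_≤ bound s σ) (sym ℕ→ℚ-0) (bound-nonneg s σ)))
    ]′ (toSum (s ℕ.≟ r))
  below-threshold (initial m) s s<r σ 2≤∣σ∣ _ _ _ =
    subst (λ Ps → ℕ→ℚ (count Ps σ) ≤ θ G τ s σ) (sym (if-≡ᵇ-other (ℕP.<⇒≢ s<r)))
      (subst (_≤ θ G τ s σ) (sym ℕ→ℚ-0) (θ-nonneg s σ 2≤∣σ∣))
  saturated (initial m) s σ ()

  final : ∀ m → Invariant n (P (run m)) (Γ (run m))
  final m = subst (λ k → Invariant k (P (run m)) (Γ (run m))) (ℕP.+-identityʳ n)
    (foldl-vertices (step m) (λ w st → Invariant w (P st) (Γ st)) (step-preserves m) n (λ i → i) (λ _ → refl) (initial m))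

-- Lemma 3.1.  Both parts follow from the invariant after the last vertex:
-- the first is its bound itself; for the second, a member σ of Γ_{s-1} has
-- reached θ_{s-1}(σ), which dominates 2^{s-1} τ times the bound on d_s(σ).
lemma3p1 : ∀ {r n : ℕ} → 2 ≤ℕ r → (G : RGraph r n) → 0ℚ < avgDeg G →
  (τ ζ : ℚ) → 0ℚ < τ → 0ℚ < ζ → (m : Mode G) →
  let st = Algo.run G τ ζ m in
  (∀ (s : ℕ) → 2 ≤ℕ s → s ≤ℕ r → ∀ (σ : Subset n) → 2 ≤ℕ ∣ σ ∣ → ∣ σ ∣ ≤ℕ s →
    ℕ→ℚ (dS G st s σ) ≤
      two^ (r C 2) * sumTo (r ∸ s) (λ ℓ →
        (two^- ((s +ℕ ℓ) C 2) * two^ ℓ) *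
          ((τ ^ℚ ((r ∸ s) ∸ ℓ)) * ℕ→ℚ (degMax G (∣ σ ∣ +ℕ ℓ) σ))))
  ×
  (∀ (s : ℕ) → 2 ≤ℕ s → s ≤ℕ r → ∀ (σ : Subset n) → 2 ≤ℕ ∣ σ ∣ → ∣ σ ∣ ≤ℕ s ∸ 1 →
    σ ∈ Γ st (s ∸ 1) →
    (two^ (s ∸ 1) * τ) * ℕ→ℚ (dS G st s σ) ≤ ℕ→ℚ (dS G st (s ∸ 1) σ))
lemma3p1 {r} {n} 2≤r G _ τ ζ 0<τ _ m = bounded inv , saturation-gap
  where
  open Container 2≤r G τ ζ (ℚP.<⇒≤ 0<τ)
  open Invariant
  end : State G
  end = Algo.run G τ ζ m
  inv : Invariant n (P end) (Γ end)
  inv = final m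
  saturation-gap : ∀ s → 2 ≤ℕ s → s ≤ℕ r → ∀ σ → 2 ≤ℕ ∣ σ ∣ → ∣ σ ∣ ≤ℕ s ∸ 1 → σ ∈ Γ end (s ∸ 1) →
                   (two^ (s ∸ 1) * τ) * ℕ→ℚ (dS G end s σ) ≤ ℕ→ℚ (dS G end (s ∸ 1) σ)
  saturation-gap (suc s) (s≤s 1≤s) s+1≤r σ 2≤∣σ∣ ∣σ∣≤s σ∈Γ = begin
    (two^ s * τ) * ℕ→ℚ (dS G end (suc s) σ)  ≤⟨ *-monoˡ-≤-nonneg (*-nonneg (two^-nonneg s) (ℚP.<⇒≤ 0<τ))
                                                 (bounded inv (suc s) (s≤s 1≤s) s+1≤r σ 2≤∣σ∣ (ℕP.m≤n⇒m≤1+n ∣σ∣≤s)) ⟩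
    (two^ s * τ) * bound (suc s) σ           ≤⟨ scaled-bound≤θ s σ s+1≤r 2≤∣σ∣ ⟩
    θ G τ s σ                                ≤⟨ saturated inv s σ σ∈Γ ⟩
    ℕ→ℚ (dS G end s σ) ∎
    where open ℚP.≤-Reasoning
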